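{- Let $\mathcal{M}$ be the set of Motzkin meanders that contain neither $UH$ nor $HU$ as a contiguous subword, and let $S(u)=\sum_{w\in\mathcal{M}} z^{|w|}u^{\mathrm{level}(w)}$. Put $$W=\sqrt{(1+z-2z^2-z^3)(1-3z+2z^2-z^3)},\qquad r_1=\frac{1-z+z^3-W}{2z(1-z)}.$$ Then $$S(u)=\frac{(1-z^2u)r_1}{z(1-u(1-z)r_1)},$$ and for every $j\ge1$ the generating function of the meanders in $\mathcal{M}$ ending at level $j$ is $[u^j]S(u)=\frac{(1-z)^jr_1^{j+1}}{z}-z(1-z)^{j-1}r_1^{j}$.
   Context: A Motzkin meander is a finite word $w$ over $\{U,H,D\}$ (heights $+1,0,-1$) all of whose prefixes have nonnegative height sum; $|w|$ is its length and $\mathrm{level}(w)$ its total height sum; the empty word is included; excursions are meanders of level $0$. "Contains $XY$ as a contiguous subword" means two consecutive letters are $X$ then $Y$. Generating functions are formal power series in $z$; $W$ is the formal power series square root with constant term $1$; $[u^j]$ is coefficient extraction. -}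

module Defs where

open import Data.Nat as ℕ using (ℕ; zero; suc; _∸_)
open import Data.Integer as ℤ using (ℤ; +_)
open import Data.Rational as ℚ using (ℚ; 0ℚ; 1ℚ)
open import Data.List using (List; []; _∷_; length; filter; map; concatMap; inits; foldr; upTo)
open import Data.List.Relation.Unary.All using (All)
open import Data.List.Relation.Unary.All.Properties using ()
import Data.List.Relation.Unary.All as All
open import Data.List.Relation.Binary.Infix.Heterogeneous using (Infix)
open import Data.List.Relation.Binary.Infix.Heterogeneous.Properties using (infix?)
open import Data.Product using (_×_)
open import Relation.Nullary using (Dec; yes; no; ¬_)
open import Relation.Nullary.Decidable using (_×-dec_; ¬?)
open import Relation.Binary.PropositionalEquality using (_≡_; refl)

data Step : Set where
  U H D : Step

height : Step → ℤ
height U = + 1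
height H = + 0
height D = ℤ.- (+ 1)

level : List Step → ℤ
level = foldr (λ s acc → height s ℤ.+ acc) (+ 0)

_≟ₛ_ : (a b : Step) → Dec (a ≡ b)
U ≟ₛ U = yes refl
U ≟ₛ H = no λ ()
U ≟ₛ D = no λ ()
H ≟ₛ U = no λ ()
H ≟ₛ H = yes refl
H ≟ₛ D = no λ ()
D ≟ₛ U = no λ ()
D ≟ₛ H = no λ ()
D ≟ₛ D = yes refl

IsMeander : List Step → Set
IsMeander w = All (λ p → + 0 ℤ.≤ level p) (inits w)

Contains : Step → Step → List Step → Set
Contains X Y w = Infix _≡_ (X ∷ Y ∷ []) w

InM : List Step → Set
InM w = IsMeander w × (¬ Contains U H w) × (¬ Contains H U w)

inM? : (w : List Step) → Dec (InM w)
inM? w = All.all? (λ p → + 0 ℤ.≤? level p) (inits w)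
         ×-dec (¬? (infix? _≟ₛ_ (U ∷ H ∷ []) w)
         ×-dec ¬? (infix? _≟ₛ_ (H ∷ U ∷ []) w))

words : ℕ → List (List Step)
words zero = [] ∷ []
words (suc n) = concatMap (λ w → (U ∷ w) ∷ (H ∷ w) ∷ (D ∷ w) ∷ []) (words n)

countM : ℕ → ℕ → ℕ
countM n j = length (filter (λ w → inM? w ×-dec (level w ℤ.≟ + j)) (words n))

PS : Set
PS = ℕ → ℚ

_≐_ : PS → PS → Set
f ≐ g = ∀ n → f n ≡ g n

sumQ : List ℚ → ℚ
sumQ = foldr ℚ._+_ 0ℚ

cst : ℚ → PS
cst c zero = c
cst c (suc n) = 0ℚ

ℤtoℚ : ℤ → ℚ
ℤtoℚ k = k ℚ./ 1

zPS : PS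
zPS 1 = 1ℚ
zPS _ = 0ℚ

infixl 6 _⊕_ _⊖_
infixl 7 _⊗_

_⊕_ : PS → PS → PS
(f ⊕ g) n = f n ℚ.+ g n

_⊖_ : PS → PS → PS
(f ⊖ g) n = f n ℚ.- g n

_⊗_ : PS → PS → PS
(f ⊗ g) n = sumQ (map (λ i → f i ℚ.* g (n ∸ i)) (upTo (suc n)))

_^ₚ_ : PS → ℕ → PS
f ^ₚ zero = cst 1ℚ
f ^ₚ suc k = f ⊗ (f ^ₚ k)

-- division by z (exact when the constant term vanishes): (f/z)_n = f_{n+1}
divZ : PS → PS
divZ f n = f (suc n)

-- Bivariate series Σ_j u^j F_j(z), represented as j ↦ F_j

BPS : Set
BPS = ℕ → PS

_≐₂_ : BPS → BPS → Set
F ≐₂ G = ∀ j → F j ≐ G j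

_⊗₂_ : BPS → BPS → BPS
(F ⊗₂ G) j = λ n → sumQ (map (λ i → (F i ⊗ G (j ∸ i)) n) (upTo (suc j)))

liftU : PS → BPS
liftU f zero = f
liftU f (suc j) = cst 0ℚ

linU : PS → PS → BPS
linU a b zero = a
linU a b (suc zero) = b
linU a b (suc (suc j)) = cst 0ℚ

S : BPS
S j n = ℤtoℚ (+ countM n j)

polyA polyB : PS
polyA 0 = 1ℚ
polyA 1 = 1ℚ
polyA 2 = ℤtoℚ (ℤ.- (+ 2))
polyA 3 = ℤtoℚ (ℤ.- (+ 1))
polyA _ = 0ℚ
polyB 0 = 1ℚ
polyB 1 = ℤtoℚ (ℤ.- (+ 3))
polyB 2 = ℤtoℚ (+ 2)
polyB 3 = ℤtoℚ (ℤ.- (+ 1))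
polyB _ = 0ℚ

polyN : PS
polyN 0 = 1ℚ
polyN 1 = ℤtoℚ (ℤ.- (+ 1))
polyN 3 = 1ℚ
polyN _ = 0ℚ

one : PS
one = cst 1ℚ

{-# OPTIONS --safe #-}
-- A word lies in 𝓜 iff an automaton reading it letter by letter, remembering the height and the
-- last letter, never fails.  Grouping the words of length n and level j by their last letter (the
-- empty word counting as ending with D) gives linear recurrences in n, so the generating functions
-- are the unique solution of a linear system over ℚ[[z]].
-- With N = 1 − z + z³ one has N² − AB = 4z²(1−z), so squaring W = N − 2z(1−z)r₁ shows
-- z(1−z)r₁² − N r₁ + z = 0.  Hence r₁(0) = 0 and E = r₁/z satisfies z²(1−z)E² − N E + 1 = 0.
-- With q = z(1−z)E, the series S₀ = E, S_{j+1} = q^j (q − z²) E, split by last letter, solve the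
-- linear system modulo this quadratic, so they are the [u^j]S(u); both claims then reduce to
-- identities in the commutative ring ℚ[[z]].
module Submission where

open import Defs
open import Data.Bool using (Bool; true; false; if_then_else_; _∧_)
open import Data.Nat as ℕ using (ℕ; zero; suc; _+_; _∸_)
import Data.Nat.Properties as ℕ
import Data.Nat.Coprimality as Coprime
open import Data.Nat.ListAction using (sum)
open import Data.Nat.ListAction.Properties using (sum-++)
open import Data.Nat.Tactic.RingSolver using () renaming (solve-∀ to ℕ-solve-∀)
open import Data.Integer as ℤ using (+_; +≤+)
import Data.Integer.Properties as ℤ
open import Data.Rational as ℚ using (ℚ; 0ℚ; 1ℚ; mkℚ)
import Data.Rational.Properties as ℚ
open import Data.List using (List; []; _∷_; foldl; map; inits; _∷ʳ_; concatMap; length; filter; applyUpTo; upTo)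
open import Data.List.Properties using (map-cong; map-++; foldl-∷ʳ)
open import Data.List.Relation.Unary.All as All using (All; []; _∷_)
open import Data.List.Relation.Unary.All.Properties using (map⁺; map⁻)
open import Data.List.Relation.Binary.Infix.Heterogeneous using (here; there)
open import Data.List.Relation.Binary.Prefix.Heterogeneous using ([]; _∷_)
open import Data.Maybe using (Maybe; just; nothing)
import Data.Maybe as Maybe
open import Data.Product using (_×_; _,_; ∃)
open import Data.Empty using (⊥-elim)
open import Function using (_∘_; id)
open import Relation.Nullary using (¬_; Dec; does; yes; no)
open import Relation.Nullary.Decidable using (_×-dec_; dec-true; dec-false; dec⇒maybe)
open import Relation.Binary.PropositionalEquality
open import Relation.Binary.Structures using (IsEquivalence)
open import Relation.Binary.Bundles using (Setoid)
import Relation.Binary.Reasoning.Setoid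
import Algebra.Properties.Group
import Algebra.Properties.CommutativeSemigroup
open import Algebra.Bundles using (CommutativeRing)
open import Algebra.Structures using (IsCommutativeSemiring)
open import Algebra.Solver.Ring.AlmostCommutativeRing
  using (AlmostCommutativeRing; _-Raw-AlmostCommutative⟶_)
import Tactic.RingSolver.Core.AlmostCommutativeRing as Reflective
open import Tactic.RingSolver using (solve-∀)

ℚ-ring : Reflective.AlmostCommutativeRing _ _
ℚ-ring = Reflective.fromCommutativeRing ℚ.+-*-commutativeRing (λ x → dec⇒maybe (0ℚ ℚ.≟ x))

0ₚ : PS
0ₚ _ = 0ℚ

≐-isEquivalence : IsEquivalence _≐_
≐-isEquivalence = record
  { refl = λ _ → refl ; sym = λ f≐g n → sym (f≐g n) ; trans = λ f≐g g≐h n → trans (f≐g n) (g≐h n) }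

≐-setoid : Setoid _ _
≐-setoid = record { isEquivalence = ≐-isEquivalence }

open IsEquivalence ≐-isEquivalence
  using () renaming (refl to ≐-refl; sym to ≐-sym; trans to ≐-trans)

cst-0≐0ₚ : cst 0ℚ ≐ 0ₚ
cst-0≐0ₚ zero = refl
cst-0≐0ₚ (suc n) = refl

map-applyUpTo : ∀ {A : Set} (ψ : ℕ → A) f m → map ψ (applyUpTo f m) ≡ applyUpTo (ψ ∘ f) m
map-applyUpTo ψ f zero = refl
map-applyUpTo ψ f (suc m) = cong (ψ (f 0) ∷_) (map-applyUpTo ψ (f ∘ suc) m)

convolution : (ℕ → ℕ → ℚ) → ℕ → ℚ
convolution φ m = sumQ (map (λ i → φ i (m ∸ i)) (upTo (suc m)))

convolution-zero : ∀ φ → convolution φ 0 ≡ φ 0 0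
convolution-zero φ = ℚ.+-identityʳ (φ 0 0)

convolution-suc : ∀ φ m → convolution φ (suc m) ≡ φ 0 (suc m) ℚ.+ convolution (φ ∘ suc) m
convolution-suc φ m = cong (λ xs → φ 0 (suc m) ℚ.+ sumQ xs)
  (trans (map-applyUpTo (λ i → φ i (suc m ∸ i)) suc (suc m))
         (sym (map-applyUpTo (λ i → φ (suc i) (m ∸ i)) id (suc m))))

⊗-at-0 : ∀ f g → (f ⊗ g) 0 ≡ f 0 ℚ.* g 0
⊗-at-0 f g = convolution-zero (λ i k → f i ℚ.* g k)

⊗-at-suc : ∀ f g n → (f ⊗ g) (suc n) ≡ f 0 ℚ.* g (suc n) ℚ.+ (divZ f ⊗ g) n
⊗-at-suc f g = convolution-suc (λ i k → f i ℚ.* g k)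

⊗-at-sucʳ : ∀ f g n → (f ⊗ g) (suc n) ≡ (f ⊗ divZ g) n ℚ.+ f (suc n) ℚ.* g 0
⊗-at-sucʳ f g zero = begin
  (f ⊗ g) 1                             ≡⟨ ⊗-at-suc f g 0 ⟩
  f 0 ℚ.* g 1 ℚ.+ (divZ f ⊗ g) 0        ≡⟨ cong₂ ℚ._+_ (sym (⊗-at-0 f (divZ g))) (⊗-at-0 (divZ f) g) ⟩
  (f ⊗ divZ g) 0 ℚ.+ f 1 ℚ.* g 0        ∎
  where open ≡-Reasoning
⊗-at-sucʳ f g (suc n) = begin
  (f ⊗ g) (suc (suc n))                                       ≡⟨ ⊗-at-suc f g (suc n) ⟩
  f 0 ℚ.* g (suc (suc n)) ℚ.+ (divZ f ⊗ g) (suc n)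
    ≡⟨ cong (f 0 ℚ.* g (suc (suc n)) ℚ.+_) (⊗-at-sucʳ (divZ f) g n) ⟩
  f 0 ℚ.* g (suc (suc n)) ℚ.+ ((divZ f ⊗ divZ g) n ℚ.+ last)
    ≡⟨ ℚ.+-assoc (f 0 ℚ.* g (suc (suc n))) ((divZ f ⊗ divZ g) n) last ⟨
  f 0 ℚ.* g (suc (suc n)) ℚ.+ (divZ f ⊗ divZ g) n ℚ.+ last    ≡⟨ cong (ℚ._+ last) (⊗-at-suc f (divZ g) n) ⟨
  (f ⊗ divZ g) (suc n) ℚ.+ last                               ∎
  where
  open ≡-Reasoning
  last : ℚ
  last = f (suc (suc n)) ℚ.* g 0

⊗-cong : ∀ {f f′ g g′} → f ≐ f′ → g ≐ g′ → (f ⊗ g) ≐ (f′ ⊗ g′)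
⊗-cong {f} {f′} {g} {g′} f≐f′ g≐g′ zero =
  trans (⊗-at-0 f g) (trans (cong₂ ℚ._*_ (f≐f′ 0) (g≐g′ 0)) (sym (⊗-at-0 f′ g′)))
⊗-cong {f} {f′} {g} {g′} f≐f′ g≐g′ (suc n) =
  trans (⊗-at-suc f g n)
    (trans (cong₂ ℚ._+_ (cong₂ ℚ._*_ (f≐f′ 0) (g≐g′ (suc n))) (⊗-cong (f≐f′ ∘ suc) g≐g′ n))
      (sym (⊗-at-suc f′ g′ n)))

⊕-cong : ∀ {f f′ g g′} → f ≐ f′ → g ≐ g′ → (f ⊕ g) ≐ (f′ ⊕ g′)
⊕-cong f≐f′ g≐g′ n = cong₂ ℚ._+_ (f≐f′ n) (g≐g′ n)

⊖-cong : ∀ {f f′ g g′} → f ≐ f′ → g ≐ g′ → (f ⊖ g) ≐ (f′ ⊖ g′)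
⊖-cong f≐f′ g≐g′ n = cong₂ ℚ._-_ (f≐f′ n) (g≐g′ n)

⊗-zeroˡ : ∀ f g → f ≐ 0ₚ → (f ⊗ g) ≐ 0ₚ
⊗-zeroˡ f g f≐0 zero = begin
  (f ⊗ g) 0      ≡⟨ ⊗-at-0 f g ⟩
  f 0 ℚ.* g 0    ≡⟨ cong (ℚ._* g 0) (f≐0 0) ⟩
  0ℚ ℚ.* g 0     ≡⟨ ℚ.*-zeroˡ (g 0) ⟩
  0ℚ             ∎
  where open ≡-Reasoning
⊗-zeroˡ f g f≐0 (suc n) = begin
  (f ⊗ g) (suc n)                          ≡⟨ ⊗-at-suc f g n ⟩
  f 0 ℚ.* g (suc n) ℚ.+ (divZ f ⊗ g) n
    ≡⟨ cong₂ ℚ._+_ (cong (ℚ._* g (suc n)) (f≐0 0)) (⊗-zeroˡ (divZ f) g (f≐0 ∘ suc) n) ⟩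
  0ℚ ℚ.* g (suc n) ℚ.+ 0ℚ                  ≡⟨ cong (ℚ._+ 0ℚ) (ℚ.*-zeroˡ (g (suc n))) ⟩
  0ℚ                                       ∎
  where open ≡-Reasoning

cst-⊗ : ∀ c g n → (cst c ⊗ g) n ≡ c ℚ.* g n
cst-⊗ c g zero = ⊗-at-0 (cst c) g
cst-⊗ c g (suc n) =
  trans (⊗-at-suc (cst c) g n)
    (trans (cong (c ℚ.* g (suc n) ℚ.+_) (⊗-zeroˡ (divZ (cst c)) g (λ _ → refl) n)) (ℚ.+-identityʳ _))

⊗-comm : ∀ f g → (f ⊗ g) ≐ (g ⊗ f)
⊗-comm f g zero = trans (⊗-at-0 f g) (trans (ℚ.*-comm (f 0) (g 0)) (sym (⊗-at-0 g f)))
⊗-comm f g (suc n) = begin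
  (f ⊗ g) (suc n)                              ≡⟨ ⊗-at-suc f g n ⟩
  f 0 ℚ.* g (suc n) ℚ.+ (divZ f ⊗ g) n         ≡⟨ cong₂ ℚ._+_ (ℚ.*-comm (f 0) (g (suc n))) (⊗-comm (divZ f) g n) ⟩
  g (suc n) ℚ.* f 0 ℚ.+ (g ⊗ divZ f) n         ≡⟨ ℚ.+-comm (g (suc n) ℚ.* f 0) ((g ⊗ divZ f) n) ⟩
  (g ⊗ divZ f) n ℚ.+ g (suc n) ℚ.* f 0         ≡⟨ ⊗-at-sucʳ g f n ⟨
  (g ⊗ f) (suc n)                              ∎
  where open ≡-Reasoning

⊗-distribˡ-⊕ : ∀ f g h → (f ⊗ (g ⊕ h)) ≐ ((f ⊗ g) ⊕ (f ⊗ h))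
⊗-distribˡ-⊕ f g h zero =
  trans (⊗-at-0 f (g ⊕ h)) (trans (ℚ.*-distribˡ-+ (f 0) (g 0) (h 0)) (sym (cong₂ ℚ._+_ (⊗-at-0 f g) (⊗-at-0 f h))))
⊗-distribˡ-⊕ f g h (suc n) = begin
  (f ⊗ (g ⊕ h)) (suc n)                                          ≡⟨ ⊗-at-suc f (g ⊕ h) n ⟩
  f 0 ℚ.* (g (suc n) ℚ.+ h (suc n)) ℚ.+ (divZ f ⊗ (g ⊕ h)) n
    ≡⟨ cong (f 0 ℚ.* (g (suc n) ℚ.+ h (suc n)) ℚ.+_) (⊗-distribˡ-⊕ (divZ f) g h n) ⟩
  f 0 ℚ.* (g (suc n) ℚ.+ h (suc n)) ℚ.+ ((divZ f ⊗ g) n ℚ.+ (divZ f ⊗ h) n)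
    ≡⟨ regroup (f 0) (g (suc n)) (h (suc n)) _ _ ⟩
  (f 0 ℚ.* g (suc n) ℚ.+ (divZ f ⊗ g) n) ℚ.+ (f 0 ℚ.* h (suc n) ℚ.+ (divZ f ⊗ h) n)
    ≡⟨ cong₂ ℚ._+_ (⊗-at-suc f g n) (⊗-at-suc f h n) ⟨
  ((f ⊗ g) ⊕ (f ⊗ h)) (suc n)                                    ∎
  where
  open ≡-Reasoning
  regroup : ∀ a b c d e → a ℚ.* (b ℚ.+ c) ℚ.+ (d ℚ.+ e) ≡ (a ℚ.* b ℚ.+ d) ℚ.+ (a ℚ.* c ℚ.+ e)
  regroup = solve-∀ ℚ-ring

⊗-distribʳ-⊕ : ∀ f g h → ((g ⊕ h) ⊗ f) ≐ ((g ⊗ f) ⊕ (h ⊗ f))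
⊗-distribʳ-⊕ f g h n =
  trans (⊗-comm (g ⊕ h) f n) (trans (⊗-distribˡ-⊕ f g h n) (cong₂ ℚ._+_ (⊗-comm f g n) (⊗-comm f h n)))

divZ-⊗ : ∀ f g → divZ (f ⊗ g) ≐ ((cst (f 0) ⊗ divZ g) ⊕ (divZ f ⊗ g))
divZ-⊗ f g n = trans (⊗-at-suc f g n) (cong (ℚ._+ (divZ f ⊗ g) n) (sym (cst-⊗ (f 0) (divZ g) n)))

⊗-assoc : ∀ f g h → ((f ⊗ g) ⊗ h) ≐ (f ⊗ (g ⊗ h))
⊗-assoc f g h zero =
  trans (⊗-at-0 (f ⊗ g) h) (trans (cong (ℚ._* h 0) (⊗-at-0 f g))
    (trans (ℚ.*-assoc (f 0) (g 0) (h 0)) (trans (cong (f 0 ℚ.*_) (sym (⊗-at-0 g h))) (sym (⊗-at-0 f (g ⊗ h))))))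
⊗-assoc f g h (suc n) = begin
  ((f ⊗ g) ⊗ h) (suc n)                                         ≡⟨ ⊗-at-suc (f ⊗ g) h n ⟩
  (f ⊗ g) 0 ℚ.* h (suc n) ℚ.+ (divZ (f ⊗ g) ⊗ h) n
    ≡⟨ cong₂ ℚ._+_ (cong (ℚ._* h (suc n)) (⊗-at-0 f g)) (⊗-cong {g = h} (divZ-⊗ f g) ≐-refl n) ⟩
  f 0 ℚ.* g 0 ℚ.* h (suc n) ℚ.+ (((cst (f 0) ⊗ divZ g) ⊕ (divZ f ⊗ g)) ⊗ h) n
    ≡⟨ cong (f 0 ℚ.* g 0 ℚ.* h (suc n) ℚ.+_) (⊗-distribʳ-⊕ h (cst (f 0) ⊗ divZ g) (divZ f ⊗ g) n) ⟩
  f 0 ℚ.* g 0 ℚ.* h (suc n) ℚ.+ (((cst (f 0) ⊗ divZ g) ⊗ h) n ℚ.+ ((divZ f ⊗ g) ⊗ h) n)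
    ≡⟨ cong (f 0 ℚ.* g 0 ℚ.* h (suc n) ℚ.+_) (cong₂ ℚ._+_ (⊗-assoc (cst (f 0)) (divZ g) h n) (⊗-assoc (divZ f) g h n)) ⟩
  f 0 ℚ.* g 0 ℚ.* h (suc n) ℚ.+ ((cst (f 0) ⊗ (divZ g ⊗ h)) n ℚ.+ (divZ f ⊗ (g ⊗ h)) n)
    ≡⟨ cong (λ x → f 0 ℚ.* g 0 ℚ.* h (suc n) ℚ.+ (x ℚ.+ (divZ f ⊗ (g ⊗ h)) n)) (cst-⊗ (f 0) (divZ g ⊗ h) n) ⟩
  f 0 ℚ.* g 0 ℚ.* h (suc n) ℚ.+ (f 0 ℚ.* (divZ g ⊗ h) n ℚ.+ (divZ f ⊗ (g ⊗ h)) n)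
    ≡⟨ regroup (f 0) (g 0) (h (suc n)) _ _ ⟩
  f 0 ℚ.* (g 0 ℚ.* h (suc n) ℚ.+ (divZ g ⊗ h) n) ℚ.+ (divZ f ⊗ (g ⊗ h)) n
    ≡⟨ cong (λ x → f 0 ℚ.* x ℚ.+ (divZ f ⊗ (g ⊗ h)) n) (⊗-at-suc g h n) ⟨
  f 0 ℚ.* (g ⊗ h) (suc n) ℚ.+ (divZ f ⊗ (g ⊗ h)) n             ≡⟨ ⊗-at-suc f (g ⊗ h) n ⟨
  (f ⊗ (g ⊗ h)) (suc n)                                         ∎
  where
  open ≡-Reasoning
  regroup : ∀ a b c d e → a ℚ.* b ℚ.* c ℚ.+ (a ℚ.* d ℚ.+ e) ≡ a ℚ.* (b ℚ.* c ℚ.+ d) ℚ.+ e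
  regroup = solve-∀ ℚ-ring

neg : PS → PS
neg f n = ℚ.- f n

neg-⊗ : ∀ f g → (neg f ⊗ g) ≐ neg (f ⊗ g)
neg-⊗ f g zero =
  trans (⊗-at-0 (neg f) g) (trans (sym (ℚ.neg-distribˡ-* (f 0) (g 0))) (cong ℚ.-_ (sym (⊗-at-0 f g))))
neg-⊗ f g (suc n) =
  trans (⊗-at-suc (neg f) g n)
    (trans (cong₂ ℚ._+_ (sym (ℚ.neg-distribˡ-* (f 0) (g (suc n)))) (neg-⊗ (divZ f) g n))
      (trans (sym (ℚ.neg-distrib-+ (f 0 ℚ.* g (suc n)) ((divZ f ⊗ g) n))) (cong ℚ.-_ (sym (⊗-at-suc f g n)))))

⊗-identityˡ : ∀ f → (one ⊗ f) ≐ f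
⊗-identityˡ f n = trans (cst-⊗ 1ℚ f n) (ℚ.*-identityˡ (f n))

⊕-⊗-isCommutativeSemiring : IsCommutativeSemiring _≐_ _⊕_ _⊗_ 0ₚ one
⊕-⊗-isCommutativeSemiring = record
  { isSemiring = record
    { isSemiringWithoutAnnihilatingZero = record
      { +-isCommutativeMonoid = record
        { isMonoid = record
          { isSemigroup = record
            { isMagma = record { isEquivalence = ≐-isEquivalence ; ∙-cong = ⊕-cong }
            ; assoc = λ f g h n → ℚ.+-assoc (f n) (g n) (h n) }
          ; identity = (λ f n → ℚ.+-identityˡ (f n)) , (λ f n → ℚ.+-identityʳ (f n)) }
        ; comm = λ f g n → ℚ.+-comm (f n) (g n) }
      ; *-cong = ⊗-cong
      ; *-assoc = ⊗-assoc
      ; *-identity = ⊗-identityˡ , (λ f → ≐-trans (⊗-comm f one) (⊗-identityˡ f))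
      ; distrib = ⊗-distribˡ-⊕ , ⊗-distribʳ-⊕ }
    ; zero = (λ f → ⊗-zeroˡ 0ₚ f ≐-refl) , (λ f → ≐-trans (⊗-comm f 0ₚ) (⊗-zeroˡ 0ₚ f ≐-refl)) }
  ; *-comm = ⊗-comm }

PS-ring : AlmostCommutativeRing _ _
PS-ring = record
  { isAlmostCommutativeRing = record
    { isCommutativeSemiring = ⊕-⊗-isCommutativeSemiring
    ; -‿cong = λ f≐g n → cong ℚ.-_ (f≐g n)
    ; -‿*-distribˡ = neg-⊗
    ; -‿+-comm = λ f g n → sym (ℚ.neg-distrib-+ (f n) (g n)) } }

cst-homomorphism : CommutativeRing.rawRing ℚ.+-*-commutativeRing -Raw-AlmostCommutative⟶ PS-ring
cst-homomorphism = record
  { ⟦_⟧ = cst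
  ; +-homo = λ { a b zero → refl ; a b (suc n) → sym (ℚ.+-identityʳ 0ℚ) }
  ; *-homo = λ { a b zero → sym (⊗-at-0 (cst a) (cst b))
               ; a b (suc n) → sym (trans (cst-⊗ a (cst b) (suc n)) (ℚ.*-zeroʳ a)) }
  ; -‿homo = λ { a zero → refl ; a (suc n) → refl }
  ; 0-homo = cst-0≐0ₚ
  ; 1-homo = ≐-refl }

cst-≟ : (a b : ℚ) → Maybe (cst a ≐ cst b)
cst-≟ a b = Maybe.map (λ { refl → ≐-refl }) (dec⇒maybe (a ℚ.≟ b))

open import Algebra.Solver.Ring (CommutativeRing.rawRing ℚ.+-*-commutativeRing) PS-ring cst-homomorphism cst-≟
  using (Polynomial; solve; _:=_; con; _:+_; _:*_; _:-_; :-_)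

zPS-⊗-at-0 : ∀ f → (zPS ⊗ f) 0 ≡ 0ℚ
zPS-⊗-at-0 f = trans (⊗-at-0 zPS f) (ℚ.*-zeroˡ (f 0))

divZ-zPS-⊗ : ∀ f → divZ (zPS ⊗ f) ≐ f
divZ-zPS-⊗ f n =
  trans (⊗-at-suc zPS f n)
    (trans (cong₂ ℚ._+_ (ℚ.*-zeroˡ (f (suc n))) (⊗-cong {g = f} divZ-zPS ≐-refl n))
      (trans (ℚ.+-identityˡ _) (⊗-identityˡ f n)))
  where
  divZ-zPS : divZ zPS ≐ one
  divZ-zPS zero = refl
  divZ-zPS (suc n) = refl

zPS-⊗-divZ : ∀ f → f 0 ≡ 0ℚ → (zPS ⊗ divZ f) ≐ f
zPS-⊗-divZ f f0≡0 zero = trans (zPS-⊗-at-0 (divZ f)) (sym f0≡0)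
zPS-⊗-divZ f f0≡0 (suc n) = divZ-zPS-⊗ (divZ f) n

zPS-⊗-cancel : ∀ f → (zPS ⊗ f) ≐ 0ₚ → f ≐ 0ₚ
zPS-⊗-cancel f zf≐0 n = trans (sym (divZ-zPS-⊗ f n)) (zf≐0 (suc n))

⊗-cancel-invertible : ∀ a c f → a 0 ℚ.* c ≡ 1ℚ → (a ⊗ f) ≐ 0ₚ → f ≐ 0ₚ
⊗-cancel-invertible a c f a₀c≡1 af≐0 zero = begin
  f 0                      ≡⟨ ℚ.*-identityˡ (f 0) ⟨
  1ℚ ℚ.* f 0               ≡⟨ cong (ℚ._* f 0) a₀c≡1 ⟨
  a 0 ℚ.* c ℚ.* f 0        ≡⟨ reorder (a 0) c (f 0) ⟩
  c ℚ.* (a 0 ℚ.* f 0)      ≡⟨ cong (c ℚ.*_) (trans (sym (⊗-at-0 a f)) (af≐0 0)) ⟩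
  c ℚ.* 0ℚ                 ≡⟨ ℚ.*-zeroʳ c ⟩
  0ℚ                       ∎
  where
  open ≡-Reasoning
  reorder : ∀ x y z → x ℚ.* y ℚ.* z ≡ y ℚ.* (x ℚ.* z)
  reorder = solve-∀ ℚ-ring
⊗-cancel-invertible a c f a₀c≡1 af≐0 (suc n) = ⊗-cancel-invertible a c (divZ f) a₀c≡1 a-divZf≐0 n
  where
  f₀≡0 : f 0 ≡ 0ℚ
  f₀≡0 = ⊗-cancel-invertible a c f a₀c≡1 af≐0 0
  a-divZf≐0 : (a ⊗ divZ f) ≐ 0ₚ
  a-divZf≐0 m = begin
    (a ⊗ divZ f) m                            ≡⟨ ℚ.+-identityʳ _ ⟨
    (a ⊗ divZ f) m ℚ.+ 0ℚ
      ≡⟨ cong ((a ⊗ divZ f) m ℚ.+_) (trans (sym (ℚ.*-zeroʳ (a (suc m)))) (cong (a (suc m) ℚ.*_) (sym f₀≡0))) ⟩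
    (a ⊗ divZ f) m ℚ.+ a (suc m) ℚ.* f 0      ≡⟨ ⊗-at-sucʳ a f m ⟨
    (a ⊗ f) (suc m)                           ≡⟨ af≐0 (suc m) ⟩
    0ℚ                                        ∎
    where open ≡-Reasoning

divZ-cong : ∀ {f g} → f ≐ g → divZ f ≐ divZ g
divZ-cong f≐g = f≐g ∘ suc

convolution-diagonal : ∀ φ → (∀ i k → φ i (suc k) ≡ 0ℚ) → ∀ m → convolution φ m ≡ φ m 0
convolution-diagonal φ vanish zero = convolution-zero φ
convolution-diagonal φ vanish (suc m) =
  trans (convolution-suc φ m)
    (trans (cong (ℚ._+ convolution (φ ∘ suc) m) (vanish 0 m))
      (trans (ℚ.+-identityˡ _) (convolution-diagonal (φ ∘ suc) (vanish ∘ suc) m)))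

convolution-two-diagonals : ∀ φ → (∀ i k → φ i (suc (suc k)) ≡ 0ℚ) → ∀ m →
                            convolution φ (suc m) ≡ φ m 1 ℚ.+ φ (suc m) 0
convolution-two-diagonals φ vanish zero =
  trans (convolution-suc φ 0) (cong (φ 0 1 ℚ.+_) (convolution-zero (φ ∘ suc)))
convolution-two-diagonals φ vanish (suc m) =
  trans (convolution-suc φ (suc m))
    (trans (cong (ℚ._+ convolution (φ ∘ suc) (suc m)) (vanish 0 m))
      (trans (ℚ.+-identityˡ _) (convolution-two-diagonals (φ ∘ suc) (vanish ∘ suc) m)))

⊗-cst-0 : ∀ f n → (f ⊗ cst 0ℚ) n ≡ 0ℚ
⊗-cst-0 f n = trans (⊗-comm f (cst 0ℚ) n) (⊗-zeroˡ (cst 0ℚ) f cst-0≐0ₚ n)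

⊗₂-liftU : ∀ F g j → (F ⊗₂ liftU g) j ≐ (F j ⊗ g)
⊗₂-liftU F g j n = convolution-diagonal (λ i k → (F i ⊗ liftU g k) n) (λ i k → ⊗-cst-0 (F i) n) j

⊗₂-linU-zero : ∀ F a b → (F ⊗₂ linU a b) 0 ≐ (F 0 ⊗ a)
⊗₂-linU-zero F a b n = convolution-zero (λ i k → (F i ⊗ linU a b k) n)

⊗₂-linU-suc : ∀ F a b j → (F ⊗₂ linU a b) (suc j) ≐ (F j ⊗ b ⊕ F (suc j) ⊗ a)
⊗₂-linU-suc F a b j n =
  convolution-two-diagonals (λ i k → (F i ⊗ linU a b k) n) (λ i k → ⊗-cst-0 (F i) n) j

^ₚ-cong : ∀ {f g} → f ≐ g → ∀ m → (f ^ₚ m) ≐ (g ^ₚ m)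
^ₚ-cong f≐g zero = ≐-refl
^ₚ-cong f≐g (suc m) = ⊗-cong f≐g (^ₚ-cong f≐g m)

^ₚ-distrib-⊗ : ∀ f g m → ((f ⊗ g) ^ₚ m) ≐ ((f ^ₚ m) ⊗ (g ^ₚ m))
^ₚ-distrib-⊗ f g zero = solve 0 (con 1ℚ := con 1ℚ :* con 1ℚ) ≐-refl
^ₚ-distrib-⊗ f g (suc m) = ≐-trans (⊗-cong {f ⊗ g} ≐-refl (^ₚ-distrib-⊗ f g m))
  (solve 4 (λ f g fᵐ gᵐ → f :* g :* (fᵐ :* gᵐ) := f :* fᵐ :* (g :* gᵐ)) ≐-refl f g (f ^ₚ m) (g ^ₚ m))

horner : List ℚ → PS
horner [] = cst 0ℚ
horner (c ∷ cs) = cst c ⊕ zPS ⊗ horner cs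

coefficients : List ℚ → PS
coefficients [] _ = 0ℚ
coefficients (c ∷ cs) zero = c
coefficients (c ∷ cs) (suc n) = coefficients cs n

coefficients≐horner : ∀ cs → coefficients cs ≐ horner cs
coefficients≐horner [] n = sym (cst-0≐0ₚ n)
coefficients≐horner (c ∷ cs) zero = sym (trans (cong (c ℚ.+_) (zPS-⊗-at-0 (horner cs))) (ℚ.+-identityʳ c))
coefficients≐horner (c ∷ cs) (suc n) =
  sym (trans (cong (0ℚ ℚ.+_) (divZ-zPS-⊗ (horner cs) n)) (trans (ℚ.+-identityˡ _) (sym (coefficients≐horner cs n))))

-- horner inside solver expressions, so that the solver sees the coefficients
hornerₑ : ∀ {k} → List ℚ → Polynomial k → Polynomial k
hornerₑ [] x = con 0ℚ
hornerₑ (c ∷ cs) x = con c :+ x :* hornerₑ cs x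

coefficientsA coefficientsB coefficientsN : List ℚ
coefficientsA = 1ℚ ∷ 1ℚ ∷ ℤtoℚ (ℤ.- (+ 2)) ∷ ℤtoℚ (ℤ.- (+ 1)) ∷ []
coefficientsB = 1ℚ ∷ ℤtoℚ (ℤ.- (+ 3)) ∷ ℤtoℚ (+ 2) ∷ ℤtoℚ (ℤ.- (+ 1)) ∷ []
coefficientsN = 1ℚ ∷ ℤtoℚ (ℤ.- (+ 1)) ∷ 0ℚ ∷ 1ℚ ∷ []

polyA≐horner : polyA ≐ horner coefficientsA
polyA≐horner = ≐-trans (λ { 0 → refl ; 1 → refl ; 2 → refl ; 3 → refl ; (suc (suc (suc (suc n)))) → refl })
                       (coefficients≐horner coefficientsA)

polyB≐horner : polyB ≐ horner coefficientsB
polyB≐horner = ≐-trans (λ { 0 → refl ; 1 → refl ; 2 → refl ; 3 → refl ; (suc (suc (suc (suc n)))) → refl })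
                       (coefficients≐horner coefficientsB)

polyN≐horner : polyN ≐ horner coefficientsN
polyN≐horner = ≐-trans (λ { 0 → refl ; 1 → refl ; 2 → refl ; 3 → refl ; (suc (suc (suc (suc n)))) → refl })
                       (coefficients≐horner coefficientsN)

4ₚ : PS
4ₚ = cst (ℤtoℚ (+ 4))

N : PS
N = horner coefficientsN

Nₑ : ∀ {k} → Polynomial k → Polynomial k
Nₑ = hornerₑ coefficientsN

discriminant : (polyA ⊗ polyB) ≐ (N ⊗ N ⊖ 4ₚ ⊗ zPS ⊗ zPS ⊗ (one ⊖ zPS))
discriminant = begin
  polyA ⊗ polyB
    ≈⟨ ⊗-cong polyA≐horner polyB≐horner ⟩
  horner coefficientsA ⊗ horner coefficientsB
    ≈⟨ solve 1 (λ z → hornerₑ coefficientsA z :* hornerₑ coefficientsB z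
                   := hornerₑ coefficientsN z :* hornerₑ coefficientsN z
                      :- con (ℤtoℚ (+ 4)) :* z :* z :* (con 1ℚ :- z)) ≐-refl zPS ⟩
  N ⊗ N ⊖ 4ₚ ⊗ zPS ⊗ zPS ⊗ (one ⊖ zPS) ∎
  where open Relation.Binary.Reasoning.Setoid ≐-setoid

open Algebra.Properties.Group ℚ.+-0-group using () renaming (identityʳ-unique to +-identityʳ-unique)

⊕-identityʳ-unique : ∀ f g → (f ⊕ g) ≐ f → g ≐ 0ₚ
⊕-identityʳ-unique f g f+g≐f n = +-identityʳ-unique (f n) (g n) (f+g≐f n)

quadratic : PS → PS
quadratic r = zPS ⊗ (one ⊖ zPS) ⊗ r ⊗ r ⊖ N ⊗ r ⊕ zPS

-- By the discriminant identity, (N − 2z(1−z)r)² = AB + 4z(1−z)·quadratic r; cancel z and the unit 4(1−z).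
quadratic-root : ∀ W r → (W ⊗ W) ≐ (polyA ⊗ polyB) →
                 ((cst (ℤtoℚ (+ 2)) ⊗ zPS ⊗ (one ⊖ zPS)) ⊗ r) ≐ (polyN ⊖ W) →
                 quadratic r ≐ 0ₚ
quadratic-root W r W²≐AB 2z[1-z]r≐N-W =
  ⊗-cancel-invertible (4ₚ ⊗ (one ⊖ zPS)) (+ 1 ℚ./ 4) (quadratic r) refl
    (zPS-⊗-cancel (4ₚ ⊗ (one ⊖ zPS) ⊗ quadratic r)
      (≐-trans (≐-sym (reassociate (quadratic r)))
        (⊕-identityʳ-unique (polyA ⊗ polyB) _ AB+4z[1-z]Q≐AB)))
  where
  open Relation.Binary.Reasoning.Setoid ≐-setoid
  K : PS
  K = cst (ℤtoℚ (+ 2)) ⊗ zPS ⊗ (one ⊖ zPS) ⊗ r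
  W≐N-K : W ≐ (N ⊖ K)
  W≐N-K n = trans (x≡a-[a-x] (N n) (W n))
    (cong (ℚ._-_ (N n)) (sym (trans (2z[1-z]r≐N-W n) (cong (ℚ._- W n) (polyN≐horner n)))))
    where
    x≡a-[a-x] : ∀ a x → x ≡ a ℚ.- (a ℚ.- x)
    x≡a-[a-x] = solve-∀ ℚ-ring
  reassociate : ∀ q → (4ₚ ⊗ zPS ⊗ (one ⊖ zPS) ⊗ q) ≐ (zPS ⊗ (4ₚ ⊗ (one ⊖ zPS) ⊗ q))
  reassociate = solve 2 (λ z q → con (ℤtoℚ (+ 4)) :* z :* (con 1ℚ :- z) :* q
                               := z :* (con (ℤtoℚ (+ 4)) :* (con 1ℚ :- z) :* q)) ≐-refl zPS
  AB+4z[1-z]Q≐AB : (polyA ⊗ polyB ⊕ 4ₚ ⊗ zPS ⊗ (one ⊖ zPS) ⊗ quadratic r) ≐ (polyA ⊗ polyB)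
  AB+4z[1-z]Q≐AB = begin
    polyA ⊗ polyB ⊕ 4ₚ ⊗ zPS ⊗ (one ⊖ zPS) ⊗ quadratic r
      ≈⟨ ⊕-cong discriminant ≐-refl ⟩
    N ⊗ N ⊖ 4ₚ ⊗ zPS ⊗ zPS ⊗ (one ⊖ zPS) ⊕ 4ₚ ⊗ zPS ⊗ (one ⊖ zPS) ⊗ quadratic r
      ≈⟨ solve 3 (λ z n r → n :* n :- con (ℤtoℚ (+ 4)) :* z :* z :* (con 1ℚ :- z)
                          :+ con (ℤtoℚ (+ 4)) :* z :* (con 1ℚ :- z)
                             :* (z :* (con 1ℚ :- z) :* r :* r :- n :* r :+ z)
                          := (n :- con (ℤtoℚ (+ 2)) :* z :* (con 1ℚ :- z) :* r)
                             :* (n :- con (ℤtoℚ (+ 2)) :* z :* (con 1ℚ :- z) :* r)) ≐-refl zPS N r ⟩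
    (N ⊖ K) ⊗ (N ⊖ K)
      ≈⟨ ⊗-cong W≐N-K W≐N-K ⟨
    W ⊗ W
      ≈⟨ W²≐AB ⟩
    polyA ⊗ polyB ∎

quadratic-cong : ∀ {f g} → f ≐ g → quadratic f ≐ quadratic g
quadratic-cong f≐g =
  ⊕-cong (⊖-cong (⊗-cong (⊗-cong {zPS ⊗ (one ⊖ zPS)} ≐-refl f≐g) f≐g) (⊗-cong {N} ≐-refl f≐g)) (≐-refl {zPS})

quadratic-root-at-0 : ∀ r → quadratic r ≐ 0ₚ → r 0 ≡ 0ℚ
quadratic-root-at-0 r Q≐0 = begin
  r 0                                                ≡⟨ x≡-[0-1x] (r 0) ⟩
  ℚ.- (0ℚ ℚ.- 1ℚ ℚ.* r 0)                            ≡⟨ cong (λ x → ℚ.- (x ℚ.- 1ℚ ℚ.* r 0)) (zPS-⊗-at-0 X) ⟨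
  ℚ.- ((zPS ⊗ X) 0 ℚ.- N 0 ℚ.* r 0)                 ≡⟨ cong (λ x → ℚ.- ((zPS ⊗ X) 0 ℚ.- x)) (⊗-at-0 N r) ⟨
  ℚ.- ((zPS ⊗ X ⊖ N ⊗ r) 0)                         ≡⟨ cong ℚ.-_ (trans (sym (factor 0)) (Q≐0 0)) ⟩
  ℚ.- 0ℚ                                             ≡⟨⟩
  0ℚ                                                 ∎
  where
  open ≡-Reasoning
  X : PS
  X = one ⊕ (one ⊖ zPS) ⊗ r ⊗ r
  factor : quadratic r ≐ (zPS ⊗ X ⊖ N ⊗ r)
  factor = solve 3 (λ z n r → z :* (con 1ℚ :- z) :* r :* r :- n :* r :+ z
                           := z :* (con 1ℚ :+ (con 1ℚ :- z) :* r :* r) :- n :* r) ≐-refl zPS N r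
  x≡-[0-1x] : ∀ x → x ≡ ℚ.- (0ℚ ℚ.- 1ℚ ℚ.* x)
  x≡-[0-1x] = solve-∀ ℚ-ring

quadraticE : PS → PS
quadraticE E = zPS ⊗ zPS ⊗ (one ⊖ zPS) ⊗ E ⊗ E ⊖ N ⊗ E ⊕ one

quadratic-zPS-⊗ : ∀ E → quadratic (zPS ⊗ E) ≐ (zPS ⊗ quadraticE E)
quadratic-zPS-⊗ E = solve 3 (λ z n e →
    z :* (con 1ℚ :- z) :* (z :* e) :* (z :* e) :- n :* (z :* e) :+ z
    := z :* (z :* z :* (con 1ℚ :- z) :* e :* e :- n :* e :+ con 1ℚ)) ≐-refl zPS N E

quadraticE-divZ-root : ∀ r → quadratic r ≐ 0ₚ → quadraticE (divZ r) ≐ 0ₚ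
quadraticE-divZ-root r Q≐0 = zPS-⊗-cancel (quadraticE (divZ r))
  (≐-trans (≐-sym (quadratic-zPS-⊗ (divZ r)))
    (≐-trans (quadratic-cong (zPS-⊗-divZ r (quadratic-root-at-0 r Q≐0))) Q≐0))

allowed : Step → Step → Bool
allowed U H = false
allowed H U = false
allowed _ _ = true

climb : ℕ → Step → Maybe ℕ
climb h U = just (suc h)
climb h H = just h
climb zero D = nothing
climb (suc h) D = just h

State : Set
State = Maybe (ℕ × Step)

step : State → Step → State
step nothing a = nothing
step (just (h , l)) a = if allowed l a then Maybe.map (_, a) (climb h a) else nothing

-- The empty word starts in the state of a word ending with D: both admit every next letter.
run : List Step → State
run = foldl step (just (0 , D))

Admissible : ℕ → Step → List Step → Set
Admissible h l w = All (λ p → + 0 ℤ.≤ + h ℤ.+ level p) (inits w)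
                 × ¬ Contains U H (l ∷ w) × ¬ Contains H U (l ∷ w)

climb-level : ∀ h a {h′} → climb h a ≡ just h′ → + h′ ≡ + h ℤ.+ height a
climb-level h U refl = cong +_ (ℕ.+-comm 1 h)
climb-level h H refl = sym (ℤ.+-identityʳ (+ h))
climb-level (suc h) D refl = refl

climb-nonnegative : ∀ h a → + 0 ℤ.≤ + h ℤ.+ height a → ∃ λ h′ → climb h a ≡ just h′
climb-nonnegative h U _ = suc h , refl
climb-nonnegative h H _ = h , refl
climb-nonnegative (suc h) D _ = h , refl
climb-nonnegative zero D ()

foldl-step-nothing : ∀ w → foldl step nothing w ≡ nothing
foldl-step-nothing [] = refl
foldl-step-nothing (a ∷ w) = foldl-step-nothing w

no-pair-in-singleton : ∀ {X Y} l → ¬ Contains X Y (l ∷ [])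
no-pair-in-singleton l (here (_ ∷ ()))
no-pair-in-singleton l (there (here ()))

shift-base : ∀ h a {h′} → + h′ ≡ + h ℤ.+ height a → ∀ p → + h′ ℤ.+ level p ≡ + h ℤ.+ level (a ∷ p)
shift-base h a h′≡ p = trans (cong (ℤ._+ level p) h′≡) (ℤ.+-assoc (+ h) (height a) (level p))

avoid-∷ : ∀ {X Y} l a w → allowed X Y ≡ false → allowed l a ≡ true →
          ¬ Contains X Y (a ∷ w) → ¬ Contains X Y (l ∷ a ∷ w)
avoid-∷ l a w forbidden ok _ (here (refl ∷ refl ∷ _)) with () ← trans (sym forbidden) ok
avoid-∷ l a w forbidden ok avoids (there inner) = avoids inner

admissible-∷ : ∀ h l a w {h′} → allowed l a ≡ true → climb h a ≡ just h′ →
               Admissible h′ a w → Admissible h l (a ∷ w)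
admissible-∷ h l a w ok climbed (nonneg , noUH , noHU) =
  (+≤+ ℕ.z≤n ∷ map⁺ (All.map (λ {p} → subst (+ 0 ℤ.≤_) (shift-base h a (climb-level h a climbed) p)) nonneg))
  , avoid-∷ l a w refl ok noUH , avoid-∷ l a w refl ok noHU

allowed-avoiding : ∀ l a w → ¬ Contains U H (l ∷ a ∷ w) → ¬ Contains H U (l ∷ a ∷ w) → allowed l a ≡ true
allowed-avoiding U H w noUH _ = ⊥-elim (noUH (here (refl ∷ refl ∷ [])))
allowed-avoiding H U w _ noHU = ⊥-elim (noHU (here (refl ∷ refl ∷ [])))
allowed-avoiding U U w _ _ = refl
allowed-avoiding U D w _ _ = refl
allowed-avoiding H H w _ _ = refl
allowed-avoiding H D w _ _ = refl
allowed-avoiding D a w _ _ = refl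

run-from-sound : ∀ h l w {j l′} → foldl step (just (h , l)) w ≡ just (j , l′) →
                 Admissible h l w × + h ℤ.+ level w ≡ + j
run-from-sound h l [] refl =
  (+≤+ ℕ.z≤n ∷ [] , no-pair-in-singleton l , no-pair-in-singleton l) , ℤ.+-identityʳ (+ h)
run-from-sound h l (a ∷ w) accepted with allowed l a in ok | climb h a in climbed
... | false | _ with () ← trans (sym (foldl-step-nothing w)) accepted
... | true | nothing with () ← trans (sym (foldl-step-nothing w)) accepted
... | true | just h′ with run-from-sound h′ a w accepted
...   | admissible , h′+level≡j =
  admissible-∷ h l a w ok climbed admissible
  , trans (sym (shift-base h a (climb-level h a climbed) w)) h′+level≡j

run-from-complete : ∀ h l w j → Admissible h l w → + h ℤ.+ level w ≡ + j →
                    ∃ λ l′ → foldl step (just (h , l)) w ≡ just (j , l′)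
run-from-complete h l [] j _ h+0≡j =
  l , cong (λ k → just (k , l)) (ℤ.+-injective (trans (sym (ℤ.+-identityʳ (+ h))) h+0≡j))
run-from-complete h l (a ∷ w) j (_ ∷ nonneg , noUH , noHU) h+level≡j
  with climb-nonnegative h a (subst (+ 0 ℤ.≤_) (cong (ℤ._+_ (+ h)) (ℤ.+-identityʳ (height a))) first)
  where first = All.head (map⁻ nonneg)
... | h′ , climbed rewrite allowed-avoiding l a w noUH noHU | climbed =
  run-from-complete h′ a w j
    (All.map (λ {p} → subst (+ 0 ℤ.≤_) (sym (shift-base h a (climb-level h a climbed) p))) (map⁻ nonneg)
      , noUH ∘ there , noHU ∘ there)
    (trans (shift-base h a (climb-level h a climbed) w) h+level≡j)

admissible-from-0⇒InM : ∀ w → Admissible 0 D w → InM w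
admissible-from-0⇒InM w (nonneg , noUH , noHU) =
  All.map (λ {p} → subst (+ 0 ℤ.≤_) (ℤ.+-identityˡ (level p))) nonneg , noUH ∘ there , noHU ∘ there

InM⇒admissible-from-0 : ∀ w → InM w → Admissible 0 D w
InM⇒admissible-from-0 w (meander , noUH , noHU) =
  All.map (λ {p} → subst (+ 0 ℤ.≤_) (sym (ℤ.+-identityˡ (level p)))) meander
  , (λ { (here (() ∷ _)) ; (there inner) → noUH inner })
  , (λ { (here (() ∷ _)) ; (there inner) → noHU inner })

run-sound : ∀ w {j l} → run w ≡ just (j , l) → InM w × level w ≡ + j
run-sound w accepted with run-from-sound 0 D w accepted
... | admissible , 0+level≡j = admissible-from-0⇒InM w admissible , trans (sym (ℤ.+-identityˡ (level w))) 0+level≡j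

run-complete : ∀ w j → InM w → level w ≡ + j → ∃ λ l → run w ≡ just (j , l)
run-complete w j inM level≡j =
  run-from-complete 0 D w j (InM⇒admissible-from-0 w inM) (trans (ℤ.+-identityˡ (level w)) level≡j)

indicator : Bool → ℕ
indicator true = 1
indicator false = 0

endsAt : ℕ → State → ℕ
endsAt j nothing = 0
endsAt j (just (h , _)) = indicator (does (h ℕ.≟ j))

endsWith : Step → ℕ → State → ℕ
endsWith l j nothing = 0
endsWith l j (just (h , l′)) = indicator (does (l ≟ₛ l′) ∧ does (h ℕ.≟ j))

endsAt-by-last-letter : ∀ j o → endsAt j o ≡ endsWith U j o + (endsWith H j o + endsWith D j o)
endsAt-by-last-letter j nothing = refl
endsAt-by-last-letter j (just (h , U)) = sym (ℕ.+-identityʳ _)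
endsAt-by-last-letter j (just (h , H)) = sym (ℕ.+-identityʳ _)
endsAt-by-last-letter j (just (h , D)) = refl

indicator-dec : ∀ {P : Set} (P? : Dec P) j o → (P → ∃ λ l → o ≡ just (j , l)) →
                (∀ {h l} → o ≡ just (h , l) → h ≡ j → P) → indicator (does P?) ≡ endsAt j o
indicator-dec (yes p) j o complete _ with complete p
... | l , refl = sym (cong indicator (dec-true (j ℕ.≟ j) refl))
indicator-dec (no ¬p) j nothing _ _ = refl
indicator-dec (no ¬p) j (just (h , l)) _ sound with h ℕ.≟ j
... | yes h≡j = ⊥-elim (¬p (sound refl h≡j))
... | no h≢j = sym (cong indicator (dec-false (h ℕ.≟ j) h≢j))

indicator-accepts : ∀ w j → indicator (does (inM? w ×-dec (level w ℤ.≟ + j))) ≡ endsAt j (run w)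
indicator-accepts w j = indicator-dec (inM? w ×-dec (level w ℤ.≟ + j)) j (run w)
  (λ (inM , level≡j) → run-complete w j inM level≡j)
  (λ { accepted refl → run-sound w accepted })

Σwords : ℕ → (List Step → ℕ) → ℕ
Σwords n f = sum (map f (words n))

Σsteps : (Step → ℕ) → ℕ
Σsteps g = g U + (g H + g D)

open Algebra.Properties.CommutativeSemigroup ℕ.+-commutativeSemigroup using () renaming (interchange to +-interchange)

sum-map-+ : ∀ {A : Set} (f g : A → ℕ) xs → sum (map (λ x → f x + g x) xs) ≡ sum (map f xs) + sum (map g xs)
sum-map-+ f g [] = refl
sum-map-+ f g (x ∷ xs) = trans (cong (_+_ (f x + g x)) (sum-map-+ f g xs)) (+-interchange (f x) (g x) _ _)

sum-map-concatMap : ∀ {A B : Set} (f : B → ℕ) (g : A → List B) xs →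
                    sum (map f (concatMap g xs)) ≡ sum (map (λ x → sum (map f (g x))) xs)
sum-map-concatMap f g [] = refl
sum-map-concatMap f g (x ∷ xs) =
  trans (cong sum (map-++ f (g x) (concatMap g xs)))
    (trans (sum-++ (map f (g x)) (map f (concatMap g xs))) (cong (_+_ (sum (map f (g x)))) (sum-map-concatMap f g xs)))

sum-map-zero : ∀ {A : Set} (xs : List A) → sum (map (λ _ → 0) xs) ≡ 0
sum-map-zero [] = refl
sum-map-zero (x ∷ xs) = sum-map-zero xs

Σwords-cong : ∀ n {f g} → (∀ w → f w ≡ g w) → Σwords n f ≡ Σwords n g
Σwords-cong n f≡g = cong sum (map-cong f≡g (words n))

Σwords-+ : ∀ n f g → Σwords n (λ w → f w + g w) ≡ Σwords n f + Σwords n g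
Σwords-+ n f g = sum-map-+ f g (words n)

Σwords-cons : ∀ n f → Σwords (suc n) f ≡ Σwords n (λ w → Σsteps (λ a → f (a ∷ w)))
Σwords-cons n f = trans (sum-map-concatMap f (λ w → (U ∷ w) ∷ (H ∷ w) ∷ (D ∷ w) ∷ []) (words n))
  (Σwords-cong n (λ w → cong (λ x → f (U ∷ w) + (f (H ∷ w) + x)) (ℕ.+-identityʳ (f (D ∷ w)))))

Σsteps-comm : ∀ (f : Step → Step → ℕ) → Σsteps (λ a → Σsteps (f a)) ≡ Σsteps (λ b → Σsteps (λ a → f a b))
Σsteps-comm f = transpose (f U U) (f U H) (f U D) (f H U) (f H H) (f H D) (f D U) (f D H) (f D D)
  where
  transpose : ∀ a b c d e f g h i →
    (a + (b + c)) + ((d + (e + f)) + (g + (h + i))) ≡ (a + (d + g)) + ((b + (e + h)) + (c + (f + i)))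
  transpose = ℕ-solve-∀

Σwords-snoc : ∀ n f → Σwords (suc n) f ≡ Σwords n (λ w → Σsteps (λ a → f (w ∷ʳ a)))
Σwords-snoc zero f = Σwords-cons 0 f
Σwords-snoc (suc n) f = begin
  Σwords (suc (suc n)) f                                          ≡⟨ Σwords-cons (suc n) f ⟩
  Σwords (suc n) (λ v → Σsteps (λ a → f (a ∷ v)))                 ≡⟨ Σwords-snoc n _ ⟩
  Σwords n (λ w → Σsteps (λ b → Σsteps (λ a → f (a ∷ w ∷ʳ b))))
    ≡⟨ Σwords-cong n (λ w → Σsteps-comm (λ b a → f (a ∷ w ∷ʳ b))) ⟩
  Σwords n (λ w → Σsteps (λ a → Σsteps (λ b → f (a ∷ w ∷ʳ b))))   ≡⟨ Σwords-cons n _ ⟨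
  Σwords (suc n) (λ v → Σsteps (λ b → f (v ∷ʳ b)))                ∎
  where open ≡-Reasoning

-- transfer l n j counts the words of 𝓜 of length n and level j whose last letter is l,
-- the empty word counting as ending with D.
transfer : Step → ℕ → ℕ → ℕ
transfer U zero j = 0
transfer H zero j = 0
transfer D zero zero = 1
transfer D zero (suc j) = 0
transfer U (suc n) zero = 0
transfer U (suc n) (suc j) = transfer U n j + transfer D n j
transfer H (suc n) j = transfer H n j + transfer D n j
transfer D (suc n) j = transfer U n (suc j) + (transfer H n (suc j) + transfer D n (suc j))

step-endsWith-U-zero : ∀ o → Σsteps (λ a → endsWith U 0 (step o a)) ≡ 0
step-endsWith-U-zero nothing = refl
step-endsWith-U-zero (just (zero , U)) = refl
step-endsWith-U-zero (just (suc h , U)) = refl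
step-endsWith-U-zero (just (zero , H)) = refl
step-endsWith-U-zero (just (suc h , H)) = refl
step-endsWith-U-zero (just (zero , D)) = refl
step-endsWith-U-zero (just (suc h , D)) = refl

step-endsWith-U-suc : ∀ j o → Σsteps (λ a → endsWith U (suc j) (step o a)) ≡ endsWith U j o + endsWith D j o
step-endsWith-U-suc j nothing = refl
step-endsWith-U-suc j (just (zero , U)) = refl
step-endsWith-U-suc j (just (suc h , U)) = refl
step-endsWith-U-suc j (just (zero , H)) = refl
step-endsWith-U-suc j (just (suc h , H)) = refl
step-endsWith-U-suc j (just (zero , D)) = ℕ.+-identityʳ _
step-endsWith-U-suc j (just (suc h , D)) = ℕ.+-identityʳ _

step-endsWith-H : ∀ j o → Σsteps (λ a → endsWith H j (step o a)) ≡ endsWith H j o + endsWith D j o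
step-endsWith-H j nothing = refl
step-endsWith-H j (just (zero , U)) = refl
step-endsWith-H j (just (suc h , U)) = refl
step-endsWith-H j (just (zero , H)) = refl
step-endsWith-H j (just (suc h , H)) = refl
step-endsWith-H j (just (zero , D)) = ℕ.+-identityʳ _
step-endsWith-H j (just (suc h , D)) = ℕ.+-identityʳ _

step-endsWith-D : ∀ j o → Σsteps (λ a → endsWith D j (step o a)) ≡ endsAt (suc j) o
step-endsWith-D j nothing = refl
step-endsWith-D j (just (zero , U)) = refl
step-endsWith-D j (just (suc h , U)) = refl
step-endsWith-D j (just (zero , H)) = refl
step-endsWith-D j (just (suc h , H)) = refl
step-endsWith-D j (just (zero , D)) = refl
step-endsWith-D j (just (suc h , D)) = refl

Σwords-endsWith-step : ∀ n l j →
  Σwords (suc n) (endsWith l j ∘ run) ≡ Σwords n (λ w → Σsteps (λ a → endsWith l j (step (run w) a)))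
Σwords-endsWith-step n l j = trans (Σwords-snoc n (endsWith l j ∘ run))
  (Σwords-cong n (λ w → cong₂ _+_ (run-∷ʳ w U) (cong₂ _+_ (run-∷ʳ w H) (run-∷ʳ w D))))
  where
  run-∷ʳ : ∀ w a → endsWith l j (run (w ∷ʳ a)) ≡ endsWith l j (step (run w) a)
  run-∷ʳ w a = cong (endsWith l j) (foldl-∷ʳ step (just (0 , D)) a w)

Σwords-endsAt : ∀ n j → Σwords n (endsAt j ∘ run)
                ≡ Σwords n (endsWith U j ∘ run) + (Σwords n (endsWith H j ∘ run) + Σwords n (endsWith D j ∘ run))
Σwords-endsAt n j =
  trans (Σwords-cong n (endsAt-by-last-letter j ∘ run))
    (trans (Σwords-+ n (endsWith U j ∘ run) _) (cong (_+_ (Σwords n (endsWith U j ∘ run))) (Σwords-+ n _ _)))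

count-by-last-letter : ∀ n l j → Σwords n (endsWith l j ∘ run) ≡ transfer l n j
count-by-last-letter zero U j = refl
count-by-last-letter zero H j = refl
count-by-last-letter zero D zero = refl
count-by-last-letter zero D (suc j) = refl
count-by-last-letter (suc n) U zero =
  trans (Σwords-endsWith-step n U 0) (trans (Σwords-cong n (step-endsWith-U-zero ∘ run)) (sum-map-zero (words n)))
count-by-last-letter (suc n) U (suc j) =
  trans (Σwords-endsWith-step n U (suc j)) (trans (Σwords-cong n (step-endsWith-U-suc j ∘ run))
    (trans (Σwords-+ n _ _) (cong₂ _+_ (count-by-last-letter n U j) (count-by-last-letter n D j))))
count-by-last-letter (suc n) H j =
  trans (Σwords-endsWith-step n H j) (trans (Σwords-cong n (step-endsWith-H j ∘ run))
    (trans (Σwords-+ n _ _) (cong₂ _+_ (count-by-last-letter n H j) (count-by-last-letter n D j))))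
count-by-last-letter (suc n) D j =
  trans (Σwords-endsWith-step n D j) (trans (Σwords-cong n (step-endsWith-D j ∘ run)) (trans (Σwords-endsAt n (suc j))
    (cong₂ _+_ (count-by-last-letter n U (suc j))
      (cong₂ _+_ (count-by-last-letter n H (suc j)) (count-by-last-letter n D (suc j))))))

length-filter-sum : ∀ {A : Set} {P : A → Set} (P? : ∀ x → Dec (P x)) xs →
                    length (filter P? xs) ≡ sum (map (indicator ∘ does ∘ P?) xs)
length-filter-sum P? [] = refl
length-filter-sum P? (x ∷ xs) with does (P? x)
... | true = cong suc (length-filter-sum P? xs)
... | false = length-filter-sum P? xs

countM-by-last-letter : ∀ n j → countM n j ≡ transfer U n j + (transfer H n j + transfer D n j)
countM-by-last-letter n j = begin
  countM n j
    ≡⟨ length-filter-sum (λ w → inM? w ×-dec (level w ℤ.≟ + j)) (words n) ⟩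
  Σwords n (λ w → indicator (does (inM? w ×-dec (level w ℤ.≟ + j))))  ≡⟨ Σwords-cong n (λ w → indicator-accepts w j) ⟩
  Σwords n (endsAt j ∘ run)                                   ≡⟨ Σwords-endsAt n j ⟩
  Σwords n (endsWith U j ∘ run) + (Σwords n (endsWith H j ∘ run) + Σwords n (endsWith D j ∘ run))
    ≡⟨ cong₂ _+_ (count-by-last-letter n U j) (cong₂ _+_ (count-by-last-letter n H j) (count-by-last-letter n D j)) ⟩
  transfer U n j + (transfer H n j + transfer D n j)          ∎
  where open ≡-Reasoning

ℕtoℚ : ℕ → ℚ
ℕtoℚ m = ℤtoℚ (+ m)

ℕtoℚ≡mkℚ : ∀ m → ℕtoℚ m ≡ mkℚ (+ m) 0 (Coprime.sym (Coprime.1-coprimeTo m))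
ℕtoℚ≡mkℚ m = ℚ.normalize-coprime (Coprime.sym (Coprime.1-coprimeTo m))

ℕtoℚ-+ : ∀ a b → ℕtoℚ (a + b) ≡ ℕtoℚ a ℚ.+ ℕtoℚ b
ℕtoℚ-+ a b rewrite ℕtoℚ≡mkℚ a | ℕtoℚ≡mkℚ b =
  cong (ℚ._/ 1) (sym (cong₂ ℤ._+_ (ℤ.*-identityʳ (+ a)) (ℤ.*-identityʳ (+ b))))

ℕtoℚ-sum₃ : ∀ a b c → ℕtoℚ (a + (b + c)) ≡ ℕtoℚ a ℚ.+ (ℕtoℚ b ℚ.+ ℕtoℚ c)
ℕtoℚ-sum₃ a b c = trans (ℕtoℚ-+ a (b + c)) (cong (ℚ._+_ (ℕtoℚ a)) (ℕtoℚ-+ b c))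

record SolvesTransfer (F : Step → ℕ → PS) : Set where
  field
    U-zero : F U 0 ≐ 0ₚ
    U-suc  : ∀ j → F U (suc j) ≐ (zPS ⊗ (F U j ⊕ F D j))
    H-rec  : ∀ j → F H j ≐ (zPS ⊗ (F H j ⊕ F D j))
    D-rec  : ∀ j → F D j ≐ (liftU one j ⊕ zPS ⊗ (F U (suc j) ⊕ (F H (suc j) ⊕ F D (suc j))))

liftU-one-at-0 : ∀ j → liftU one j 0 ℚ.+ 0ℚ ≡ ℕtoℚ (transfer D 0 j)
liftU-one-at-0 zero = refl
liftU-one-at-0 (suc j) = refl

liftU-one-at-suc : ∀ j n → liftU one j (suc n) ≡ 0ℚ
liftU-one-at-suc zero n = refl
liftU-one-at-suc (suc j) n = refl

transfer-unique : ∀ {F} → SolvesTransfer F → ∀ n l j → ℕtoℚ (transfer l n j) ≡ F l j n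
transfer-unique {F} sol = unique
  where
  open SolvesTransfer sol
  next : ℕ → PS
  next j = F U (suc j) ⊕ (F H (suc j) ⊕ F D (suc j))
  at-0 : ∀ l j → F l j 0 ≡ ℕtoℚ (transfer l 0 j)
  at-0 U zero = U-zero 0
  at-0 U (suc j) = trans (U-suc j 0) (zPS-⊗-at-0 (F U j ⊕ F D j))
  at-0 H j = trans (H-rec j 0) (zPS-⊗-at-0 (F H j ⊕ F D j))
  at-0 D j = trans (D-rec j 0) (trans (cong (liftU one j 0 ℚ.+_) (zPS-⊗-at-0 (next j))) (liftU-one-at-0 j))
  unique : ∀ n l j → ℕtoℚ (transfer l n j) ≡ F l j n
  unique zero l j = sym (at-0 l j)
  unique (suc n) U zero = sym (U-zero (suc n))
  unique (suc n) U (suc j) = begin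
    ℕtoℚ (transfer U n j + transfer D n j)             ≡⟨ ℕtoℚ-+ (transfer U n j) (transfer D n j) ⟩
    ℕtoℚ (transfer U n j) ℚ.+ ℕtoℚ (transfer D n j)    ≡⟨ cong₂ ℚ._+_ (unique n U j) (unique n D j) ⟩
    (F U j ⊕ F D j) n                                  ≡⟨ divZ-zPS-⊗ (F U j ⊕ F D j) n ⟨
    (zPS ⊗ (F U j ⊕ F D j)) (suc n)                    ≡⟨ U-suc j (suc n) ⟨
    F U (suc j) (suc n)                                ∎
    where open ≡-Reasoning
  unique (suc n) H j = begin
    ℕtoℚ (transfer H n j + transfer D n j)             ≡⟨ ℕtoℚ-+ (transfer H n j) (transfer D n j) ⟩
    ℕtoℚ (transfer H n j) ℚ.+ ℕtoℚ (transfer D n j)    ≡⟨ cong₂ ℚ._+_ (unique n H j) (unique n D j) ⟩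
    (F H j ⊕ F D j) n                                  ≡⟨ divZ-zPS-⊗ (F H j ⊕ F D j) n ⟨
    (zPS ⊗ (F H j ⊕ F D j)) (suc n)                    ≡⟨ H-rec j (suc n) ⟨
    F H j (suc n)                                      ∎
    where open ≡-Reasoning
  unique (suc n) D j = begin
    ℕtoℚ (transfer U n (suc j) + (transfer H n (suc j) + transfer D n (suc j)))
      ≡⟨ ℕtoℚ-sum₃ (transfer U n (suc j)) (transfer H n (suc j)) (transfer D n (suc j)) ⟩
    ℕtoℚ (transfer U n (suc j)) ℚ.+ (ℕtoℚ (transfer H n (suc j)) ℚ.+ ℕtoℚ (transfer D n (suc j)))
      ≡⟨ cong₂ ℚ._+_ (unique n U (suc j)) (cong₂ ℚ._+_ (unique n H (suc j)) (unique n D (suc j))) ⟩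
    next j n
      ≡⟨ divZ-zPS-⊗ (next j) n ⟨
    (zPS ⊗ next j) (suc n)
      ≡⟨ ℚ.+-identityˡ _ ⟨
    0ℚ ℚ.+ (zPS ⊗ next j) (suc n)
      ≡⟨ cong (ℚ._+ (zPS ⊗ next j) (suc n)) (liftU-one-at-suc j n) ⟨
    (liftU one j ⊕ zPS ⊗ next j) (suc n)
      ≡⟨ D-rec j (suc n) ⟨
    F D j (suc n)                                      ∎
    where open ≡-Reasoning

≐-modulo-root : ∀ X Y K R → X ≐ (Y ⊕ K ⊗ R) → R ≐ 0ₚ → X ≐ Y
≐-modulo-root X Y K R X≐Y+KR R≐0 n =
  trans (X≐Y+KR n) (trans (cong (Y n ℚ.+_) (trans (⊗-comm K R n) (⊗-zeroˡ R K R≐0 n))) (ℚ.+-identityʳ (Y n)))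

-- In the paper's notation E = r₁/z, ratio E = (1−z)r₁ and levelGF E j = [u^j]S(u).
ratio : PS → PS
ratio E = zPS ⊗ (one ⊖ zPS) ⊗ E

levelGF : PS → ℕ → PS
levelGF E zero = E
levelGF E (suc k) = ratio E ^ₚ k ⊗ ((ratio E ⊖ zPS ⊗ zPS) ⊗ E)

levelGF-H levelGF-D : PS → ℕ → PS
levelGF-H E zero = zPS ⊗ E
levelGF-H E (suc k) = zPS ⊗ zPS ⊗ zPS ⊗ E ⊗ levelGF E (suc k)
levelGF-D E j = liftU one j ⊕ zPS ⊗ levelGF E (suc j)

-- Appending D to words of level j + 1 gives the D-part, the H-part solves H = z(H + D-part),
-- and the U-part is the rest.
lastLetterGF : PS → Step → ℕ → PS
lastLetterGF E U j = levelGF E j ⊖ levelGF-H E j ⊖ levelGF-D E j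
lastLetterGF E H = levelGF-H E
lastLetterGF E D = levelGF-D E

ratioₑ levelₑ : ∀ {k} → Polynomial k → Polynomial k → Polynomial k
ratioₑ z e = z :* (con 1ℚ :- z) :* e
levelₑ z e = (ratioₑ z e :- z :* z) :* e

quadraticEₑ : ∀ {k} → Polynomial k → Polynomial k → Polynomial k
quadraticEₑ z e = z :* z :* (con 1ℚ :- z) :* e :* e :- Nₑ z :* e :+ con 1ℚ

levelGF-by-last-letter : ∀ E j → levelGF E j ≐ (lastLetterGF E U j ⊕ (lastLetterGF E H j ⊕ lastLetterGF E D j))
levelGF-by-last-letter E j =
  solve 3 (λ s h t → s := (s :- h :- t) :+ (h :+ t)) ≐-refl (levelGF E j) (levelGF-H E j) (levelGF-D E j)

lastLetterGF-solves : ∀ E → quadraticE E ≐ 0ₚ → SolvesTransfer (lastLetterGF E)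
lastLetterGF-solves E root = record { U-zero = U-zero ; U-suc = U-suc ; H-rec = H-rec ; D-rec = D-rec }
  where
  U-zero : lastLetterGF E U 0 ≐ 0ₚ
  U-zero = ≐-trans (≐-modulo-root _ (cst 0ℚ) (neg one) (quadraticE E) (solve 2 (λ z e →
      e :- z :* e :- (con 1ℚ :+ z :* (con 1ℚ :* levelₑ z e))
      := con 0ℚ :+ (:- con 1ℚ) :* quadraticEₑ z e) ≐-refl zPS E) root) cst-0≐0ₚ
  U-suc : ∀ j → lastLetterGF E U (suc j) ≐ (zPS ⊗ (lastLetterGF E U j ⊕ lastLetterGF E D j))
  U-suc zero = ≐-modulo-root _ _ (neg (zPS ⊗ E)) (quadraticE E) (solve 2 (λ z e →
      con 1ℚ :* levelₑ z e :- z :* z :* z :* e :* (con 1ℚ :* levelₑ z e)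
        :- (con 0ℚ :+ z :* (ratioₑ z e :* con 1ℚ :* levelₑ z e))
      := z :* ((e :- z :* e :- (con 1ℚ :+ z :* (con 1ℚ :* levelₑ z e))) :+ (con 1ℚ :+ z :* (con 1ℚ :* levelₑ z e)))
         :+ (:- (z :* e)) :* quadraticEₑ z e) ≐-refl zPS E) root
  U-suc (suc k) = ≐-modulo-root _ _ (neg (zPS ⊗ ratio E ^ₚ k ⊗ ((ratio E ⊖ zPS ⊗ zPS) ⊗ E))) (quadraticE E)
    (solve 3 (λ z e p →
      let z³e = z :* z :* z :* e
          s₁ = p :* levelₑ z e
          s₂ = ratioₑ z e :* p :* levelₑ z e
          s₃ = ratioₑ z e :* (ratioₑ z e :* p) :* levelₑ z e
      in s₂ :- z³e :* s₂ :- (con 0ℚ :+ z :* s₃)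
         := z :* ((s₁ :- z³e :* s₁ :- (con 0ℚ :+ z :* s₂)) :+ (con 0ℚ :+ z :* s₂))
            :+ (:- (z :* p :* levelₑ z e)) :* quadraticEₑ z e) ≐-refl zPS E (ratio E ^ₚ k)) root
  H-rec : ∀ j → lastLetterGF E H j ≐ (zPS ⊗ (lastLetterGF E H j ⊕ lastLetterGF E D j))
  H-rec zero = ≐-modulo-root _ _ (neg zPS) (quadraticE E) (solve 2 (λ z e →
      z :* e := z :* (z :* e :+ (con 1ℚ :+ z :* (con 1ℚ :* levelₑ z e))) :+ (:- z) :* quadraticEₑ z e) ≐-refl zPS E) root
  H-rec (suc k) = solve 3 (λ z e p →
      let z³e = z :* z :* z :* e
      in z³e :* (p :* levelₑ z e)
         := z :* (z³e :* (p :* levelₑ z e) :+ (con 0ℚ :+ z :* (ratioₑ z e :* p :* levelₑ z e)))) ≐-refl zPS E (ratio E ^ₚ k)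
  D-rec : ∀ j → lastLetterGF E D j
              ≐ (liftU one j ⊕ zPS ⊗ (lastLetterGF E U (suc j) ⊕ (lastLetterGF E H (suc j) ⊕ lastLetterGF E D (suc j))))
  D-rec j = ⊕-cong {liftU one j} {liftU one j} ≐-refl (⊗-cong {zPS} {zPS} ≐-refl (levelGF-by-last-letter E (suc j)))

S≐levelGF : ∀ E → quadraticE E ≐ 0ₚ → ∀ j → S j ≐ levelGF E j
S≐levelGF E root j n = begin
  ℕtoℚ (countM n j)
    ≡⟨ cong ℕtoℚ (countM-by-last-letter n j) ⟩
  ℕtoℚ (transfer U n j + (transfer H n j + transfer D n j))
    ≡⟨ ℕtoℚ-sum₃ (transfer U n j) (transfer H n j) (transfer D n j) ⟩
  ℕtoℚ (transfer U n j) ℚ.+ (ℕtoℚ (transfer H n j) ℚ.+ ℕtoℚ (transfer D n j))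
    ≡⟨ cong₂ ℚ._+_ (unique n U j) (cong₂ ℚ._+_ (unique n H j) (unique n D j)) ⟩
  (lastLetterGF E U j ⊕ (lastLetterGF E H j ⊕ lastLetterGF E D j)) n
    ≡⟨ levelGF-by-last-letter E j n ⟨
  levelGF E j n ∎
  where
  open ≡-Reasoning
  unique : ∀ n l j → ℕtoℚ (transfer l n j) ≡ lastLetterGF E l j n
  unique = transfer-unique (lastLetterGF-solves E root)

levelGF-recurrence : ∀ E j →
  (levelGF E j ⊗ (cst 0ℚ ⊖ (one ⊖ zPS) ⊗ (zPS ⊗ E)) ⊕ levelGF E (suc j) ⊗ one)
  ≐ (linU one (cst 0ℚ ⊖ zPS ⊗ zPS) (suc j) ⊗ E)
levelGF-recurrence E zero = solve 2 (λ z e →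
  e :* (con 0ℚ :- (con 1ℚ :- z) :* (z :* e)) :+ con 1ℚ :* levelₑ z e :* con 1ℚ
  := (con 0ℚ :- z :* z) :* e) ≐-refl zPS E
levelGF-recurrence E (suc k) = solve 3 (λ z e p →
  p :* levelₑ z e :* (con 0ℚ :- (con 1ℚ :- z) :* (z :* e)) :+ ratioₑ z e :* p :* levelₑ z e :* con 1ℚ
  := con 0ℚ :* e) ≐-refl zPS E (ratio E ^ₚ k)

S-functional-equation : ∀ r → quadratic r ≐ 0ₚ →
  (S ⊗₂ linU one (cst 0ℚ ⊖ ((one ⊖ zPS) ⊗ r))) ≐₂ (linU one (cst 0ℚ ⊖ (zPS ⊗ zPS)) ⊗₂ liftU (divZ r))
S-functional-equation r root = coefficient
  where
  open Relation.Binary.Reasoning.Setoid ≐-setoid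
  E L M : PS
  E = divZ r
  L = cst 0ℚ ⊖ ((one ⊖ zPS) ⊗ r)
  M = cst 0ℚ ⊖ (zPS ⊗ zPS)
  S≐ : ∀ j → S j ≐ levelGF E j
  S≐ = S≐levelGF E (quadraticE-divZ-root r root)
  L≐ : L ≐ (cst 0ℚ ⊖ (one ⊖ zPS) ⊗ (zPS ⊗ E))
  L≐ = ⊖-cong {cst 0ℚ} {cst 0ℚ} ≐-refl (⊗-cong {one ⊖ zPS} ≐-refl (≐-sym (zPS-⊗-divZ r (quadratic-root-at-0 r root))))
  coefficient : (S ⊗₂ linU one L) ≐₂ (linU one M ⊗₂ liftU E)
  coefficient zero = begin
    (S ⊗₂ linU one L) 0                                   ≈⟨ ⊗₂-linU-zero S one L ⟩
    S 0 ⊗ one                                             ≈⟨ ⊗-cong (S≐ 0) ≐-refl ⟩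
    E ⊗ one                                               ≈⟨ ⊗-comm E one ⟩
    one ⊗ E                                               ≈⟨ ⊗₂-liftU (linU one M) E 0 ⟨
    (linU one M ⊗₂ liftU E) 0                             ∎
  coefficient (suc j) = begin
    (S ⊗₂ linU one L) (suc j)                             ≈⟨ ⊗₂-linU-suc S one L j ⟩
    S j ⊗ L ⊕ S (suc j) ⊗ one                             ≈⟨ ⊕-cong (⊗-cong (S≐ j) L≐) (⊗-cong (S≐ (suc j)) ≐-refl) ⟩
    levelGF E j ⊗ (cst 0ℚ ⊖ (one ⊖ zPS) ⊗ (zPS ⊗ E)) ⊕ levelGF E (suc j) ⊗ one
                                                          ≈⟨ levelGF-recurrence E j ⟩
    linU one M (suc j) ⊗ E                                ≈⟨ ⊗₂-liftU (linU one M) E (suc j) ⟨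
    (linU one M ⊗₂ liftU E) (suc j)                       ∎

levelGF-closed-form : ∀ E j → levelGF E (suc j)
  ≐ (divZ (((one ⊖ zPS) ^ₚ suc j) ⊗ ((zPS ⊗ E) ^ₚ suc (suc j))) ⊖ (zPS ⊗ ((one ⊖ zPS) ^ₚ j) ⊗ ((zPS ⊗ E) ^ₚ suc j)))
levelGF-closed-form E j = begin
  ratio E ^ₚ j ⊗ a
    ≈⟨ ⊗-cong (≐-trans (^ₚ-distrib-⊗ (zPS ⊗ C) E j) (⊗-cong (^ₚ-distrib-⊗ zPS C j) ≐-refl)) ≐-refl ⟩
  Zʲ ⊗ Cʲ ⊗ Eʲ ⊗ a
    ≈⟨ solve 5 (λ z e zʲ cʲ eʲ → zʲ :* cʲ :* eʲ :* levelₑ z e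
                 := X z e zʲ cʲ eʲ :- z :* cʲ :* ((z :* zʲ) :* (e :* eʲ))) ≐-refl zPS E Zʲ Cʲ Eʲ ⟩
  ⟦X⟧ ⊖ zPS ⊗ Cʲ ⊗ (zPS ^ₚ suc j ⊗ E ^ₚ suc j)
    ≈⟨ ⊖-cong (≐-sym (divZ-zPS-⊗ ⟦X⟧)) ≐-refl ⟩
  divZ (zPS ⊗ ⟦X⟧) ⊖ zPS ⊗ Cʲ ⊗ (zPS ^ₚ suc j ⊗ E ^ₚ suc j)
    ≈⟨ ⊖-cong (divZ-cong (solve 5 (λ z e zʲ cʲ eʲ → z :* X z e zʲ cʲ eʲ
                 := (con 1ℚ :- z) :* cʲ :* ((z :* (z :* zʲ)) :* (e :* (e :* eʲ)))) ≐-refl zPS E Zʲ Cʲ Eʲ)) ≐-refl ⟩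
  divZ (C ^ₚ suc j ⊗ (zPS ^ₚ suc (suc j) ⊗ E ^ₚ suc (suc j))) ⊖ zPS ⊗ Cʲ ⊗ (zPS ^ₚ suc j ⊗ E ^ₚ suc j)
    ≈⟨ ⊖-cong (divZ-cong (⊗-cong {C ^ₚ suc j} ≐-refl (^ₚ-distrib-⊗ zPS E (suc (suc j)))))
              (⊗-cong {zPS ⊗ Cʲ} ≐-refl (^ₚ-distrib-⊗ zPS E (suc j))) ⟨
  divZ (C ^ₚ suc j ⊗ (zPS ⊗ E) ^ₚ suc (suc j)) ⊖ zPS ⊗ Cʲ ⊗ (zPS ⊗ E) ^ₚ suc j ∎
  where
  open Relation.Binary.Reasoning.Setoid ≐-setoid
  C a Zʲ Cʲ Eʲ ⟦X⟧ : PS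
  C = one ⊖ zPS
  a = (ratio E ⊖ zPS ⊗ zPS) ⊗ E
  Zʲ = zPS ^ₚ j
  Cʲ = C ^ₚ j
  Eʲ = E ^ₚ j
  ⟦X⟧ = C ⊗ Cʲ ⊗ (zPS ^ₚ suc j ⊗ E ^ₚ suc (suc j))
  X : ∀ {k} → Polynomial k → Polynomial k → Polynomial k → Polynomial k → Polynomial k → Polynomial k
  X z e zʲ cʲ eʲ = (con 1ℚ :- z) :* cʲ :* ((z :* zʲ) :* (e :* (e :* eʲ)))

S-coefficients : ∀ r → quadratic r ≐ 0ₚ → ∀ j → S (suc j)
  ≐ (divZ (((one ⊖ zPS) ^ₚ suc j) ⊗ (r ^ₚ suc (suc j))) ⊖ (zPS ⊗ ((one ⊖ zPS) ^ₚ j) ⊗ (r ^ₚ suc j)))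
S-coefficients r root j = ≐-trans (S≐levelGF E (quadraticE-divZ-root r root) (suc j))
  (≐-trans (levelGF-closed-form E j)
    (⊖-cong (divZ-cong (⊗-cong {(one ⊖ zPS) ^ₚ suc j} ≐-refl (^ₚ-cong (≐-sym r≐zE) (suc (suc j)))))
            (⊗-cong {zPS ⊗ ((one ⊖ zPS) ^ₚ j)} ≐-refl (^ₚ-cong (≐-sym r≐zE) (suc j)))))
  where
  E : PS
  E = divZ r
  r≐zE : r ≐ (zPS ⊗ E)
  r≐zE = ≐-sym (zPS-⊗-divZ r (quadratic-root-at-0 r root))

mainTheorem4 : (W r₁ : PS) →
    (W ⊗ W) ≐ (polyA ⊗ polyB) → W 0 ≡ 1ℚ →
    ((cst (ℤtoℚ (+ 2)) ⊗ zPS ⊗ (one ⊖ zPS)) ⊗ r₁) ≐ (polyN ⊖ W) →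
    (S ⊗₂ linU one (cst 0ℚ ⊖ ((one ⊖ zPS) ⊗ r₁)))
      ≐₂ (linU one (cst 0ℚ ⊖ (zPS ⊗ zPS)) ⊗₂ liftU (divZ r₁))
    × ((j : ℕ) → S (suc j)
         ≐ (divZ (((one ⊖ zPS) ^ₚ suc j) ⊗ (r₁ ^ₚ suc (suc j)))
            ⊖ (zPS ⊗ ((one ⊖ zPS) ^ₚ j) ⊗ (r₁ ^ₚ suc j))))
mainTheorem4 W r₁ W²≐AB _ 2z[1-z]r₁≐N-W = S-functional-equation r₁ root , S-coefficients r₁ root
  where
  root : quadratic r₁ ≐ 0ₚ
  root = quadratic-root W r₁ W²≐AB 2z[1-z]r₁≐N-W
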